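{- Let $R$ be a blind bisimulation over the nodes of a $\lambda$-graph $G$. Let $n,m,m'$ be nodes of $G$ and $\tau$ a non-empty trace. If $nRm$ and $m\xrightarrow{\tau}m'$, then $nRm'$ does not hold.
   Context: A $\lambda$-graph is a finite directed graph with application nodes $\mathrm{App}(n_1,n_2)$ (left child $n_1$, direction $\swarrow$; right child $n_2$, direction $\searrow$), abstraction nodes $\mathrm{Abs}(n)$ (child $n$, direction $\downarrow$), free variable nodes (no children) and bound variable nodes (binding edge to an abstraction node), acyclic when binding edges are ignored (a path from a node to itself has empty trace), with each bound variable node dominated by its binder. Paths: $n\xrightarrow{\epsilon}n$; if $n\xrightarrow{\tau}\mathrm{Abs}(m)$ then $n\xrightarrow{\downarrow\cdot\tau}m$; if $n\xrightarrow{\tau}\mathrm{App}(m_1,m_2)$ then $n\xrightarrow{\swarrow\cdot\tau}m_1$, $n\xrightarrow{\searrow\cdot\tau}m_2$. Nodes are homogeneous if of the same kind (application, abstraction, free variable, bound variable). A blind bisimulation is a relation relating only homogeneous nodes such that $\mathrm{App}(n_1,n_2)\,R\,\mathrm{App}(m_1,m_2)$ implies $n_1Rm_1$ and $n_2Rm_2$, and $\mathrm{Abs}(n)\,R\,\mathrm{Abs}(m)$ implies $nRm$. -}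

module Defs where

open import Data.Nat using (ℕ)
open import Data.Fin using (Fin)
open import Data.List using (List; []; _∷_)
open import Data.Product using (Σ; ∃; _×_; _,_)
open import Data.Sum using (_⊎_)
open import Relation.Binary.PropositionalEquality using (_≡_)
open import Relation.Nullary using (¬_)

data Label (N : ℕ) : Set where
  app  : Fin N → Fin N → Label N
  abs  : Fin N → Label N
  fvar : Label N
  bvar : Fin N → Label N           -- bound variable with binding edge to its binder

Graph : ℕ → Set
Graph N = Fin N → Label N

data Dir : Set where
  ↙ ↘ ↓ : Dir

Trace : Set
Trace = List Dir

-- Paths n →τ m, following the paper's inductive definition
-- (the newest step is prepended to the trace).
data Path {N : ℕ} (G : Graph N) : Fin N → Fin N → Trace → Set where
  ε-path : ∀ {n} → Path G n n []
  step↓  : ∀ {n m m₁ τ} → Path G n m τ → G m ≡ abs m₁ → Path G n m₁ (↓ ∷ τ)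
  step↙  : ∀ {n m m₁ m₂ τ} → Path G n m τ → G m ≡ app m₁ m₂ → Path G n m₁ (↙ ∷ τ)
  step↘  : ∀ {n m m₁ m₂ τ} → Path G n m τ → G m ≡ app m₁ m₂ → Path G n m₂ (↘ ∷ τ)

data Through {N : ℕ} {G : Graph N} (b : Fin N) :
       ∀ {n m τ} → Path G n m τ → Set where
  th-ε     : ∀ {n} → b ≡ n → Through b (ε-path {n = n})
  th↓-here : ∀ {n m m₁ τ} {p : Path G n m τ} {e : G m ≡ abs m₁} → b ≡ m₁ → Through b (step↓ p e)
  th↓-there : ∀ {n m m₁ τ} {p : Path G n m τ} {e : G m ≡ abs m₁} → Through b p → Through b (step↓ p e)
  th↙-here : ∀ {n m m₁ m₂ τ} {p : Path G n m τ} {e : G m ≡ app m₁ m₂} → b ≡ m₁ → Through b (step↙ p e)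
  th↙-there : ∀ {n m m₁ m₂ τ} {p : Path G n m τ} {e : G m ≡ app m₁ m₂} → Through b p → Through b (step↙ p e)
  th↘-here : ∀ {n m m₁ m₂ τ} {p : Path G n m τ} {e : G m ≡ app m₁ m₂} → b ≡ m₂ → Through b (step↘ p e)
  th↘-there : ∀ {n m m₁ m₂ τ} {p : Path G n m τ} {e : G m ≡ app m₁ m₂} → Through b p → Through b (step↘ p e)

Child : ∀ {N} → Graph N → Fin N → Fin N → Set
Child G n m = (∃ λ k → G n ≡ app m k) ⊎ (∃ λ k → G n ≡ app k m) ⊎ G n ≡ abs m

Root : ∀ {N} → Graph N → Fin N → Set
Root G r = ∀ n → ¬ Child G n r

BindersAreAbs : ∀ {N} → Graph N → Set
BindersAreAbs G = ∀ x b → G x ≡ bvar b → ∃ λ c → G b ≡ abs c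

Acyclic : ∀ {N} → Graph N → Set
Acyclic G = ∀ n τ → Path G n n τ → τ ≡ []

Dominated : ∀ {N} → Graph N → Set
Dominated G = ∀ x b → G x ≡ bvar b → ∀ r → Root G r →
              ∀ τ (p : Path G r x τ) → Through b p

record IsLambdaGraph {N : ℕ} (G : Graph N) : Set where
  field
    binders   : BindersAreAbs G
    acyclic   : Acyclic G
    dominated : Dominated G

data Kind : Set where
  kApp kAbs kFVar kBVar : Kind

kind : ∀ {N} → Label N → Kind
kind (app _ _) = kApp
kind (abs _)   = kAbs
kind fvar      = kFVar
kind (bvar _)  = kBVar

Homogeneous : ∀ {N} → Graph N → Fin N → Fin N → Set
Homogeneous G n m = kind (G n) ≡ kind (G m)

record BlindBisimulation {N : ℕ} (G : Graph N) (R : Fin N → Fin N → Set) : Set where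
  field
    homogeneous : ∀ n m → R n m → Homogeneous G n m
    app-cong : ∀ n m n₁ n₂ m₁ m₂ → G n ≡ app n₁ n₂ → G m ≡ app m₁ m₂ →
               R n m → R n₁ m₁ × R n₂ m₂
    abs-cong : ∀ n m n₁ m₁ → G n ≡ abs n₁ → G m ≡ abs m₁ → R n m → R n₁ m₁

module Submission where

-- A blind bisimulation R can transport paths in both directions:
-- if x R y, every path out of y is matched by a path out of x with the same
-- trace whose endpoints are again related, and (since the converse of a blind
-- bisimulation is one too) every path out of x is matched by one out of y.
-- Suppose n R m, n R m′ and m →τ m′ with τ non-empty.  Transporting m →τ m′
-- along n R m yields n →τ n′ with n′ R m′; transporting n →τ n′ back along
-- n R m′ yields m′ →τ m″ with n′ R m″.  The configuration (n′, m′, m″) has the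
-- same shape as (n, m, m′), so the step can be repeated forever, giving an
-- infinite walk m → m′ → m″ → ⋯ whose steps have non-empty traces.  In a graph
-- with finitely many nodes such a walk revisits a node (pigeonhole), which
-- produces a cycle with non-empty trace and contradicts acyclicity.

open import Defs
open import Data.Nat using (ℕ; zero; suc; _≤′_; ≤′-refl; ≤′-step)
open import Data.Nat.Properties using (n<1+n; <⇒<′)
open import Data.Empty using (⊥)
open import Data.Fin using (Fin; toℕ)
open import Data.Fin.Properties using (pigeonhole)
open import Data.List using ([]; _++_)
open import Data.List.Properties using (++-conicalˡ)
open import Data.Product using (∃; _×_; _,_; proj₁; proj₂)
open import Function using (flip)
open import Relation.Binary.PropositionalEquality using (_≡_; _≢_; refl; sym; trans; cong; subst)
open import Relation.Nullary using (¬_)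

_▹_ : ∀ {N} {G : Graph N} {a b c σ τ} → Path G a b σ → Path G b c τ → Path G a c (τ ++ σ)
p ▹ ε-path     = p
p ▹ step↓ q e  = step↓ (p ▹ q) e
p ▹ step↙ q e  = step↙ (p ▹ q) e
p ▹ step↘ q e  = step↘ (p ▹ q) e

Descent : ∀ {N} → Graph N → Fin N → Fin N → Set
Descent G a b = ∃ λ σ → Path G a b σ × σ ≢ []

descent-trans : ∀ {N} {G : Graph N} {a b c} → Descent G a b → Descent G b c → Descent G a c
descent-trans (σ , p , σ≢[]) (τ , q , τ≢[]) =
  τ ++ σ , p ▹ q , λ τσ≡[] → τ≢[] (++-conicalˡ τ σ τσ≡[])

descent-between : ∀ {N} {G : Graph N} (y : ℕ → Fin N) →
  (∀ i → Descent G (y i) (y (suc i))) → ∀ {i j} → suc i ≤′ j → Descent G (y i) (y j)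
descent-between y descends ≤′-refl       = descends _
descent-between y descends (≤′-step i<j) =
  descent-trans (descent-between y descends i<j) (descends _)

-- In an acyclic graph on finitely many nodes there is no infinite sequence of
-- nodes in which each one properly descends from the previous one: two of the
-- first N+1 nodes coincide, and the descent between them is a forbidden cycle.
no-infinite-descent : ∀ {N} (G : Graph N) → Acyclic G →
  (y : ℕ → Fin N) → (∀ i → Descent G (y i) (y (suc i))) → ⊥
no-infinite-descent {N} G acyclic y descends
  with pigeonhole (n<1+n N) (λ (k : Fin (suc N)) → y (toℕ k))
... | i , j , i<j , yi≡yj with descent-between y descends (<⇒<′ i<j)
...   | σ , p , σ≢[] = σ≢[] (acyclic _ σ (subst (λ a → Path G a (y (toℕ j)) σ) yi≡yj p))

kind-abs : ∀ {N} (l : Label N) → kind l ≡ kAbs → ∃ λ k → l ≡ abs k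
kind-abs (abs k) _ = k , refl
kind-abs (app _ _) ()
kind-abs fvar ()
kind-abs (bvar _) ()

kind-app : ∀ {N} (l : Label N) → kind l ≡ kApp → ∃ λ k₁ → ∃ λ k₂ → l ≡ app k₁ k₂
kind-app (app k₁ k₂) _ = k₁ , k₂ , refl
kind-app (abs _) ()
kind-app fvar ()
kind-app (bvar _) ()

-- The converse of a blind bisimulation is a blind bisimulation; this lets
-- paths be transported in both directions with a single lemma.
converse : ∀ {N} {G : Graph N} {R : Fin N → Fin N → Set} →
  BlindBisimulation G R → BlindBisimulation G (flip R)
converse B = record
  { homogeneous = λ n m r → sym (homogeneous m n r)
  ; app-cong    = λ n m n₁ n₂ m₁ m₂ en em r → app-cong m n m₁ m₂ n₁ n₂ em en r
  ; abs-cong    = λ n m n₁ m₁ en em r → abs-cong m n m₁ n₁ em en r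
  }
  where open BlindBisimulation B

module Transport {N} {G : Graph N} {R : Fin N → Fin N → Set} (B : BlindBisimulation G R) where
  open BlindBisimulation B

  abs-child : ∀ {x y y₁} → R x y → G y ≡ abs y₁ → ∃ λ x₁ → G x ≡ abs x₁ × R x₁ y₁
  abs-child {x} {y} r e with kind-abs (G x) (trans (homogeneous x y r) (cong kind e))
  ... | x₁ , e′ = x₁ , e′ , abs-cong x y x₁ _ e′ e r

  app-children : ∀ {x y y₁ y₂} → R x y → G y ≡ app y₁ y₂ →
    ∃ λ x₁ → ∃ λ x₂ → G x ≡ app x₁ x₂ × R x₁ y₁ × R x₂ y₂
  app-children {x} {y} r e with kind-app (G x) (trans (homogeneous x y r) (cong kind e))
  ... | x₁ , x₂ , e′ = x₁ , x₂ , e′ , app-cong x y x₁ x₂ _ _ e′ e r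

  simulate : ∀ {x y y′ σ} → R x y → Path G y y′ σ → ∃ λ x′ → Path G x x′ σ × R x′ y′
  simulate r ε-path = _ , ε-path , r
  simulate r (step↓ p e) with simulate r p
  ... | _ , q , r′ with abs-child r′ e
  ...   | x₁ , e′ , r₁ = x₁ , step↓ q e′ , r₁
  simulate r (step↙ p e) with simulate r p
  ... | _ , q , r′ with app-children r′ e
  ...   | x₁ , _ , e′ , r₁ , _ = x₁ , step↙ q e′ , r₁
  simulate r (step↘ p e) with simulate r p
  ... | _ , q , r′ with app-children r′ e
  ...   | _ , x₂ , e′ , _ , r₂ = x₂ , step↘ q e′ , r₂

-- A configuration records a source node related to both ends of a τ-path.
-- The hypotheses of the theorem are exactly such a configuration.
module Configurations {N} (G : Graph N) (R : Fin N → Fin N → Set)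
                      (B : BlindBisimulation G R) (τ : Trace) where

  record Configuration : Set where
    field
      source start end : Fin N
      source-start     : R source start
      source-end       : R source end
      path             : Path G start end τ

  -- The next configuration starts where the current one ends: transporting
  -- start →τ end along source R start gives source →τ x′ with x′ R end, and
  -- transporting that path back along source R end gives end →τ y with x′ R y.
  next : Configuration → Configuration
  next c = record
    { source       = proj₁ forth
    ; start        = end
    ; end          = proj₁ back
    ; source-start = proj₂ (proj₂ forth)
    ; source-end   = proj₂ (proj₂ back)
    ; path         = proj₁ (proj₂ back)
    }
    where
    open Configuration c
    forth : ∃ λ x′ → Path G source x′ τ × R x′ end
    forth = Transport.simulate B source-start path
    back : ∃ λ y → Path G end y τ × R (proj₁ forth) y
    back = Transport.simulate (converse B) source-end (proj₁ (proj₂ forth))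

  orbit : Configuration → ℕ → Configuration
  orbit c zero    = c
  orbit c (suc k) = next (orbit c k)

mainTheorem8 : ∀ {N : ℕ} (G : Graph N) → IsLambdaGraph G →
    (R : Fin N → Fin N → Set) → BlindBisimulation G R →
    ∀ (n m m′ : Fin N) (τ : Trace) → ¬ (τ ≡ []) →
    R n m → Path G m m′ τ → ¬ R n m′
mainTheorem8 G isλ R B n m m′ τ τ≢[] n-m m→m′ n-m′ =
  no-infinite-descent G (IsLambdaGraph.acyclic isλ) (λ k → start (walk k))
    (λ k → τ , path (walk k) , τ≢[])
  where
  open Configurations G R B τ
  open Configuration
  walk : ℕ → Configuration
  walk = orbit (record { source = n ; start = m ; end = m′
                       ; source-start = n-m ; source-end = n-m′ ; path = m→m′ })
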